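{- For positive integers $a,b,c$, let $\mathsf{nwwnip}(a,b,c)$ be the number of web worlds whose set of pegs incident to at least one edge is exactly $\{1,\dots,a\}$, whose diagrams have exactly $b$ edges, and in which exactly $c$ distinct pairs of pegs are joined by at least one edge. Then $$\mathsf{nwwnip}(a,b,c)=\binom{b-1}{c-1}\sum_{k}\binom ak\binom{\binom k2}{c}(-1)^{a-k}.$$
   Context: A web diagram with $L$ edges is a set $D=\{(x_j,y_j,a_j,b_j):1\le j\le L\}$ of distinct 4-tuples of positive integers with $x_j<y_j$ (edge from peg $x_j$ at height $a_j$ to peg $y_j$ at height $b_j$) such that for each peg $i$ the heights of the endpoints on peg $i$ are exactly $1,\dots,p_i$, where $p_i$ is the number of endpoints on peg $i$. The web world $W(D)$ is the set of all diagrams obtained from $D$ by permuting the heights independently on each peg. A web world is determined by the numbers $a_{ij}$ ($i<j$) of edges joining pegs $i$ and $j$ in any of its diagrams, and every choice of nonnegative integers $a_{ij}$ arises. -}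

module Defs where

open import Data.Nat using (ℕ; zero; suc; _+_; _∸_; _<_; _≤_)
open import Data.Nat.Combinatorics using (_C_)
open import Data.Fin using (Fin; toℕ)
open import Data.Vec using (Vec; lookup; toList)
open import Data.List using (List; length; filter; map; concat; upTo)
open import Data.Nat.ListAction using (sum)
open import Data.Product using (∃; _×_)
open import Data.Integer as ℤ using (ℤ; +_)
open import Relation.Binary.PropositionalEquality using (_≡_; _≢_)
open import Relation.Nullary.Decidable using (¬?)
open import Data.Nat.Properties using (_≟_)
open import Function.Bundles using (_⇔_)
open import Data.List.Relation.Unary.Unique.Propositional using (Unique)
open import Data.List.Membership.Propositional using (_∈_)

-- A web world on pegs 1..a (here indexed by Fin a) is represented by its
-- edge-multiplicity data: M i j = number of edges joining pegs i and j.
-- Only entries with i < j are meaningful; the others are required to be 0.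
Mult : ℕ → Set
Mult a = Vec (Vec ℕ a) a

entry : ∀ {a} → Mult a → Fin a → Fin a → ℕ
entry M i j = lookup (lookup M i) j

entries : ∀ {a} → Mult a → List ℕ
entries M = concat (map toList (toList M))

numEdges : ∀ {a} → Mult a → ℕ
numEdges M = sum (entries M)

numPairs : ∀ {a} → Mult a → ℕ
numPairs M = length (filter (λ n → ¬? (n ≟ 0)) (entries M))

IsWW : (a b c : ℕ) → Mult a → Set
IsWW a b c M =
  (∀ (i j : Fin a) → toℕ j ≤ toℕ i → entry M i j ≡ 0)
  × (∀ (i : Fin a) → ∃ λ (j : Fin a) → (entry M i j ≢ 0) Data.Sum.⊎ (entry M j i ≢ 0))
  × numEdges M ≡ b
  × numPairs M ≡ c
  where import Data.Sum

HasCount : {A : Set} → (A → Set) → ℕ → Set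
HasCount {A} P n = ∃ λ (xs : List A) → Unique xs × (∀ x → (x ∈ xs) ⇔ P x) × length xs ≡ n

sumℤ : List ℤ → ℤ
sumℤ = Data.List.foldr ℤ._+_ (+ 0)
  where import Data.List

altSum : ℕ → ℕ → ℤ
altSum a c = sumℤ (map (λ k → (+ (a C k)) ℤ.* (+ ((k C 2) C c)) ℤ.* (ℤ.-1ℤ ℤ.^ (a ∸ k))) (upTo (suc a)))

module Submission where

-- Counting web worlds by inclusion–exclusion.
--
-- A web world on pegs 1..a is a strictly upper-triangular matrix M of edge
-- multiplicities.  Fixing the number b of edges and the number c of joined
-- pairs, the worlds in which every peg is incident to an edge are counted as
-- follows.
--  * For a Boolean mask S on the a×a positions, the matrices supported on S with
--    entry sum b and c nonzero entries number  C(#S, c) · W(b, c),  where W(b, c)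
--    counts compositions of b into c positive parts and W(b+1, c+1) = C(b, c).
--    They are enumerated explicitly (as flattened vectors) by a duplicate-free list.
--  * For an upper-triangular matrix, requiring the pegs of a set U to be isolated
--    is the same as being supported on the mask of pairs i < j avoiding U, which
--    has C(a − |U|, 2) positions.
--  * Inclusion–exclusion over U, then grouping the subsets U by size, gives
--      #worlds = W(b, c) · Σ_k C(a, k) C(C(k, 2), c) (−1)^(a−k).

module ListSums where

  open import Data.Nat using (ℕ; suc)
  open import Data.Integer using (ℤ; 0ℤ; _+_; _*_)
  import Data.Integer.Properties as ℤP
  open import Data.Integer.Tactic.RingSolver using (solve-∀)
  open import Data.List using (List; []; _∷_; _++_; map; upTo)
  import Data.List.Properties as LP
  open import Relation.Binary.PropositionalEquality
  open import Function using (_∘_)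
  open import Defs using (sumℤ)

  -- Σ_{x ∈ xs} f x; built on the sum used in Defs so that altSum is such a sum.
  ∑ : {A : Set} → List A → (A → ℤ) → ℤ
  ∑ xs f = sumℤ (map f xs)

  module _ {A : Set} where

    ∑-cong : (xs : List A) {f g : A → ℤ} → (∀ x → f x ≡ g x) → ∑ xs f ≡ ∑ xs g
    ∑-cong [] e = refl
    ∑-cong (x ∷ xs) e = cong₂ _+_ (e x) (∑-cong xs e)

    ∑-++ : (xs ys : List A) (f : A → ℤ) → ∑ (xs ++ ys) f ≡ ∑ xs f + ∑ ys f
    ∑-++ [] ys f = sym (ℤP.+-identityˡ _)
    ∑-++ (x ∷ xs) ys f = trans (cong (_+_ (f x)) (∑-++ xs ys f)) (sym (ℤP.+-assoc (f x) _ _))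

    ∑-zero : (xs : List A) → ∑ xs (λ _ → 0ℤ) ≡ 0ℤ
    ∑-zero [] = refl
    ∑-zero (x ∷ xs) = trans (ℤP.+-identityˡ _) (∑-zero xs)

    ∑-+ : (xs : List A) (f g : A → ℤ) → ∑ xs (λ x → f x + g x) ≡ ∑ xs f + ∑ xs g
    ∑-+ [] f g = refl
    ∑-+ (x ∷ xs) f g = trans (cong (_+_ (f x + g x)) (∑-+ xs f g)) (interchange (f x) (g x) _ _)
      where
      interchange : ∀ (p q r s : ℤ) → (p + q) + (r + s) ≡ (p + r) + (q + s)
      interchange = solve-∀

    ∑-scale : (xs : List A) (k : ℤ) (f : A → ℤ) → ∑ xs (λ x → k * f x) ≡ k * ∑ xs f
    ∑-scale [] k f = sym (ℤP.*-zeroʳ k)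
    ∑-scale (x ∷ xs) k f = trans (cong (_+_ (k * f x)) (∑-scale xs k f)) (sym (ℤP.*-distribˡ-+ k (f x) _))

  module _ {A B : Set} where

    ∑-map : (g : A → B) (xs : List A) (f : B → ℤ) → ∑ (map g xs) f ≡ ∑ xs (f ∘ g)
    ∑-map g [] f = refl
    ∑-map g (x ∷ xs) f = cong (_+_ (f (g x))) (∑-map g xs f)

    ∑-swap : (xs : List A) (ys : List B) (f : A → B → ℤ) →
             ∑ xs (λ x → ∑ ys (f x)) ≡ ∑ ys (λ y → ∑ xs (λ x → f x y))
    ∑-swap [] ys f = sym (∑-zero ys)
    ∑-swap (x ∷ xs) ys f = trans (cong (_+_ (∑ ys (f x))) (∑-swap xs ys f)) (sym (∑-+ ys (f x) _))

  ∑-upTo-suc : ∀ n (f : ℕ → ℤ) → ∑ (upTo (suc n)) f ≡ f 0 + ∑ (upTo n) (f ∘ suc)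
  ∑-upTo-suc n f =
    cong (_+_ (f 0)) (cong sumℤ (trans (LP.map-applyUpTo suc f n)
                                       (sym (LP.map-applyUpTo (λ k → k) (f ∘ suc) n))))

  ∑-upTo-∷ʳ : ∀ n (f : ℕ → ℤ) → ∑ (upTo (suc n)) f ≡ ∑ (upTo n) f + f n
  ∑-upTo-∷ʳ n f = begin
    ∑ (upTo (suc n)) f              ≡⟨ cong (λ ks → ∑ ks f) (sym (LP.upTo-∷ʳ n)) ⟩
    ∑ (upTo n ++ n ∷ []) f          ≡⟨ ∑-++ (upTo n) (n ∷ []) f ⟩
    ∑ (upTo n) f + (f n + 0ℤ)       ≡⟨ cong (_+_ (∑ (upTo n) f)) (ℤP.+-identityʳ (f n)) ⟩
    ∑ (upTo n) f + f n              ∎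
    where open ≡-Reasoning

module InclusionExclusion where

  open import Data.Nat using (ℕ; zero; suc)
  open import Data.Bool using (Bool; true; false; _∧_; not; T)
  open import Data.Bool.Properties using (T-∧)
  open import Data.Fin using (Fin; zero; suc)
  open import Data.Vec using (Vec; []; _∷_; lookup)
  open import Data.Integer using (ℤ; +_; 0ℤ; 1ℤ; -1ℤ; _+_; _*_; -_; _-_; _^_)
  import Data.Integer.Properties as ℤP
  open import Data.Integer.Tactic.RingSolver using (solve-∀)
  open import Data.List using (List; []; _∷_; _++_; map; length; filterᵇ)
  open import Data.Product using (_,_; proj₁; proj₂)
  open import Data.Unit using (tt)
  open import Function using (_∘_; _⇔_; mk⇔; Equivalence)
  open import Relation.Nullary using (¬_)
  open import Relation.Binary.PropositionalEquality
  open ListSums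

  open Equivalence using (to; from)

  size : ∀ {n} → Vec Bool n → ℕ
  size [] = 0
  size (true ∷ U) = suc (size U)
  size (false ∷ U) = size U

  subsets : (a : ℕ) → List (Vec Bool a)
  subsets zero = [] ∷ []
  subsets (suc a) = map (false ∷_) (subsets a) ++ map (true ∷_) (subsets a)

  every : ∀ {a} → (Fin a → Bool) → Bool
  every {zero} p = true
  every {suc a} p = p zero ∧ every (p ∘ suc)

  noneIn : ∀ {a} → Vec Bool a → (Fin a → Bool) → Bool
  noneIn [] p = true
  noneIn (false ∷ U) p = noneIn U (p ∘ suc)
  noneIn (true ∷ U) p = not (p zero) ∧ noneIn U (p ∘ suc)

  T-every : ∀ {a} (p : Fin a → Bool) → T (every p) ⇔ (∀ i → T (p i))
  T-every {zero} p = mk⇔ (λ _ ()) (λ _ → tt)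
  T-every {suc a} p = mk⇔ forth back
    where
    forth : T (every p) → ∀ i → T (p i)
    forth h zero = proj₁ (T-∧ .to h)
    forth h (suc i) = T-every (p ∘ suc) .to (proj₂ (T-∧ .to h)) i
    back : (∀ i → T (p i)) → T (every p)
    back h = T-∧ .from (h zero , T-every (p ∘ suc) .from (h ∘ suc))

  T-not : ∀ {x} → T (not x) ⇔ (¬ T x)
  T-not {true} = mk⇔ (λ ()) (λ h → h tt)
  T-not {false} = mk⇔ (λ _ ()) (λ _ → tt)

  T-noneIn : ∀ {a} (U : Vec Bool a) (p : Fin a → Bool) →
             T (noneIn U p) ⇔ (∀ i → lookup U i ≡ true → ¬ T (p i))
  T-noneIn [] p = mk⇔ (λ _ ()) (λ _ → tt)
  T-noneIn (false ∷ U) p = mk⇔ forth back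
    where
    forth : T (noneIn U (p ∘ suc)) → ∀ i → lookup (false ∷ U) i ≡ true → ¬ T (p i)
    forth h (suc i) = T-noneIn U (p ∘ suc) .to h i
    back : (∀ i → lookup (false ∷ U) i ≡ true → ¬ T (p i)) → T (noneIn U (p ∘ suc))
    back h = T-noneIn U (p ∘ suc) .from (h ∘ suc)
  T-noneIn (true ∷ U) p = mk⇔ forth back
    where
    forth : T (not (p zero) ∧ noneIn U (p ∘ suc)) → ∀ i → lookup (true ∷ U) i ≡ true → ¬ T (p i)
    forth h zero _ = T-not .to (proj₁ (T-∧ .to h))
    forth h (suc i) = T-noneIn U (p ∘ suc) .to (proj₂ (T-∧ .to h)) i
    back : (∀ i → lookup (true ∷ U) i ≡ true → ¬ T (p i)) → T (not (p zero) ∧ noneIn U (p ∘ suc))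
    back h = T-∧ .from (T-not .from (h zero refl) , T-noneIn U (p ∘ suc) .from (h ∘ suc))

  indicator : Bool → ℤ
  indicator true = 1ℤ
  indicator false = 0ℤ

  indicator-∧ : ∀ x y → indicator (x ∧ y) ≡ indicator x * indicator y
  indicator-∧ true true = refl
  indicator-∧ true false = refl
  indicator-∧ false true = refl
  indicator-∧ false false = refl
  indicator-not : ∀ x → indicator x ≡ 1ℤ - indicator (not x)
  indicator-not true = refl
  indicator-not false = refl

  -- Pointwise form: [∀ i. p i] = Π_i (1 − [¬ p i]) = Σ_U (−1)^|U| [∀ i ∈ U. ¬ p i].
  -- Induction on a splits the subsets by whether they contain 0.
  inclusion-exclusion₁ : ∀ {a} (p : Fin a → Bool) →
    indicator (every p) ≡ ∑ (subsets a) (λ U → -1ℤ ^ size U * indicator (noneIn U p))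
  inclusion-exclusion₁ {zero} p = refl
  inclusion-exclusion₁ {suc a} p = begin
    indicator (p zero ∧ every q)
      ≡⟨ indicator-∧ (p zero) (every q) ⟩
    indicator (p zero) * indicator (every q)
      ≡⟨ cong₂ _*_ (indicator-not (p zero)) (inclusion-exclusion₁ q) ⟩
    (1ℤ - n) * S
      ≡⟨ expand n S ⟩
    S + (- n) * S
      ≡⟨ cong (_+_ S) (sym (∑-scale (subsets a) (- n) F)) ⟩
    S + ∑ (subsets a) (λ U → (- n) * F U)
      ≡⟨ cong (_+_ S) (∑-cong (subsets a) addZero) ⟩
    S + ∑ (subsets a) (G ∘ (true ∷_))
      ≡⟨ cong₂ _+_ (sym (∑-map (false ∷_) (subsets a) G)) (sym (∑-map (true ∷_) (subsets a) G)) ⟩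
    ∑ (map (false ∷_) (subsets a)) G + ∑ (map (true ∷_) (subsets a)) G
      ≡⟨ sym (∑-++ (map (false ∷_) (subsets a)) _ G) ⟩
    ∑ (subsets (suc a)) G ∎
    where
    open ≡-Reasoning
    q = p ∘ suc
    n = indicator (not (p zero))
    F : Vec Bool a → ℤ
    F U = -1ℤ ^ size U * indicator (noneIn U q)
    S = ∑ (subsets a) F
    G : Vec Bool (suc a) → ℤ
    G U = -1ℤ ^ size U * indicator (noneIn U p)
    expand : ∀ x y → (1ℤ - x) * y ≡ y + (- x) * y
    expand = solve-∀
    -- adding 0 to U flips the sign and adds the condition ¬ p 0
    addZero : ∀ U → (- n) * F U ≡ G (true ∷ U)
    addZero U = trans (shuffle n (-1ℤ ^ size U) (indicator (noneIn U q)))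
                      (cong (-1ℤ * -1ℤ ^ size U *_) (sym (indicator-∧ (not (p zero)) (noneIn U q))))
      where
      shuffle : ∀ x s i → (- x) * (s * i) ≡ -1ℤ * s * (x * i)
      shuffle = solve-∀

  count-∑ : {A : Set} (q : A → Bool) (xs : List A) → + length (filterᵇ q xs) ≡ ∑ xs (indicator ∘ q)
  count-∑ q [] = refl
  count-∑ q (x ∷ xs) with q x
  ... | true = cong (_+_ 1ℤ) (count-∑ q xs)
  ... | false = trans (count-∑ q xs) (sym (ℤP.+-identityˡ _))

  inclusion-exclusion : {A : Set} {a : ℕ} (ps : A → Fin a → Bool) (xs : List A) →
    + length (filterᵇ (every ∘ ps) xs)
      ≡ ∑ (subsets a) (λ U → -1ℤ ^ size U * + length (filterᵇ (noneIn U ∘ ps) xs))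
  inclusion-exclusion {a = a} ps xs = begin
    + length (filterᵇ (every ∘ ps) xs)
      ≡⟨ count-∑ (every ∘ ps) xs ⟩
    ∑ xs (λ x → indicator (every (ps x)))
      ≡⟨ ∑-cong xs (λ x → inclusion-exclusion₁ (ps x)) ⟩
    ∑ xs (λ x → ∑ (subsets a) (λ U → -1ℤ ^ size U * indicator (noneIn U (ps x))))
      ≡⟨ ∑-swap xs (subsets a) _ ⟩
    ∑ (subsets a) (λ U → ∑ xs (λ x → -1ℤ ^ size U * indicator (noneIn U (ps x))))
      ≡⟨ ∑-cong (subsets a) (λ U → trans (∑-scale xs (-1ℤ ^ size U) _)
                                        (cong (-1ℤ ^ size U *_) (sym (count-∑ (noneIn U ∘ ps) xs)))) ⟩
    ∑ (subsets a) (λ U → -1ℤ ^ size U * + length (filterᵇ (noneIn U ∘ ps) xs)) ∎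
    where open ≡-Reasoning

module SubsetsBySize where

  open import Data.Nat as ℕ using (ℕ; zero; suc; _∸_; s≤s)
  open import Data.Nat.Combinatorics using (_C_; nCk+nC[k+1]≡[n+1]C[k+1]; k>n⇒nCk≡0)
  import Data.Nat.Properties as ℕP
  open import Data.Bool using (Bool; true; false; not)
  open import Data.Vec as Vec using (Vec; _∷_)
  open import Data.Integer using (ℤ; +_; 0ℤ; _+_; _*_)
  import Data.Integer.Properties as ℤP
  open import Data.Integer.Tactic.RingSolver using (solve-∀)
  open import Data.List using (map; upTo)
  open import Relation.Nullary using (yes; no)
  open import Relation.Binary.PropositionalEquality
  open ListSums
  open InclusionExclusion using (size; subsets)

  -- Σ_{k ≤ a} C(a, k) h(a − k, k): k elements outside, a − k inside.
  binomialSum : ℕ → (ℕ → ℕ → ℤ) → ℤ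
  binomialSum a h = ∑ (upTo (suc a)) (λ k → + (a C k) * h (a ∸ k) k)

  -- Pascal's rule lifted to binomial sums: the new element lies outside or inside.
  binomialSum-suc : ∀ a (h : ℕ → ℕ → ℤ) →
    binomialSum (suc a) h ≡ binomialSum a (λ t f → h t (suc f)) + binomialSum a (λ t f → h (suc t) f)
  binomialSum-suc a h = begin
    binomialSum (suc a) h
      ≡⟨ ∑-upTo-suc (suc a) (λ k → + (suc a C k) * h (suc a ∸ k) k) ⟩
    g 0 + ∑ (upTo (suc a)) (λ k → + (suc a C suc k) * h (a ∸ k) (suc k))
      ≡⟨ cong (_+_ (g 0)) (∑-cong (upTo (suc a)) pascal) ⟩
    g 0 + ∑ (upTo (suc a)) (λ k → f k + + (a C suc k) * h (a ∸ k) (suc k))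
      ≡⟨ cong (_+_ (g 0)) (∑-+ (upTo (suc a)) f _) ⟩
    g 0 + (B₁ + ∑ (upTo (suc a)) (λ k → + (a C suc k) * h (a ∸ k) (suc k)))
      ≡⟨ cong (λ z → g 0 + (B₁ + z)) (∑-cong (upTo (suc a)) shift) ⟩
    g 0 + (B₁ + ∑ (upTo (suc a)) (λ k → g (suc k)))
      ≡⟨ swap (g 0) B₁ _ ⟩
    B₁ + (g 0 + ∑ (upTo (suc a)) (λ k → g (suc k)))
      ≡⟨ cong (_+_ B₁) (sym (∑-upTo-suc (suc a) g)) ⟩
    B₁ + ∑ (upTo (suc (suc a))) g
      ≡⟨ cong (_+_ B₁) (∑-upTo-∷ʳ (suc a) g) ⟩
    B₁ + (B₂ + g (suc a))
      ≡⟨ cong (λ z → B₁ + (B₂ + z)) topVanishes ⟩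
    B₁ + (B₂ + 0ℤ)
      ≡⟨ cong (_+_ B₁) (ℤP.+-identityʳ B₂) ⟩
    B₁ + B₂ ∎
    where
    open ≡-Reasoning
    f g : ℕ → ℤ
    f k = + (a C k) * h (a ∸ k) (suc k)
    g k = + (a C k) * h (suc (a ∸ k)) k
    B₁ = binomialSum a (λ t f → h t (suc f))
    B₂ = binomialSum a (λ t f → h (suc t) f)
    pascal : ∀ k → + (suc a C suc k) * h (a ∸ k) (suc k) ≡ f k + + (a C suc k) * h (a ∸ k) (suc k)
    pascal k = begin
      + (suc a C suc k) * x                 ≡⟨ cong (λ m → + m * x) (sym (nCk+nC[k+1]≡[n+1]C[k+1] a k)) ⟩
      + (a C k ℕ.+ a C suc k) * x           ≡⟨ ℤP.*-distribʳ-+ x (+ (a C k)) (+ (a C suc k)) ⟩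
      + (a C k) * x + + (a C suc k) * x     ∎
      where x = h (a ∸ k) (suc k)
    -- a − k = 1 + (a − (k+1)) whenever the coefficient C(a, k+1) is nonzero
    shift : ∀ k → + (a C suc k) * h (a ∸ k) (suc k) ≡ g (suc k)
    shift k with k ℕ.<? a
    ... | yes k<a = cong (λ t → + (a C suc k) * h t (suc k)) (ℕP.+-∸-assoc 1 k<a)
    ... | no k≮a = trans (cong (λ m → + m * h (a ∸ k) (suc k)) beyondTop)
                         (sym (cong (λ m → + m * h (suc (a ∸ suc k)) (suc k)) beyondTop))
      where beyondTop = k>n⇒nCk≡0 (s≤s (ℕP.≮⇒≥ k≮a))
    topVanishes : g (suc a) ≡ 0ℤ
    topVanishes = trans (cong (λ m → + m * h (suc (a ∸ suc a)) (suc a)) (k>n⇒nCk≡0 (ℕP.n<1+n a)))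
                        (ℤP.*-zeroˡ (h (suc (a ∸ suc a)) (suc a)))
    swap : ∀ x y z → x + (y + z) ≡ y + (x + z)
    swap = solve-∀

  subsets-by-size : ∀ a (h : ℕ → ℕ → ℤ) →
    ∑ (subsets a) (λ U → h (size U) (size (Vec.map not U))) ≡ binomialSum a h
  subsets-by-size zero h = cong (_+ 0ℤ) (sym (ℤP.*-identityˡ (h 0 0)))
  subsets-by-size (suc a) h = begin
    ∑ (subsets (suc a)) F
      ≡⟨ ∑-++ (map (false ∷_) (subsets a)) _ F ⟩
    ∑ (map (false ∷_) (subsets a)) F + ∑ (map (true ∷_) (subsets a)) F
      ≡⟨ cong₂ _+_ (∑-map (false ∷_) (subsets a) F) (∑-map (true ∷_) (subsets a) F) ⟩
    ∑ (subsets a) (λ U → h (size U) (suc (size (Vec.map not U))))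
      + ∑ (subsets a) (λ U → h (suc (size U)) (size (Vec.map not U)))
      ≡⟨ cong₂ _+_ (subsets-by-size a (λ t f → h t (suc f)))
                   (subsets-by-size a (λ t f → h (suc t) f)) ⟩
    binomialSum a (λ t f → h t (suc f)) + binomialSum a (λ t f → h (suc t) f)
      ≡⟨ sym (binomialSum-suc a h) ⟩
    binomialSum (suc a) h ∎
    where
    open ≡-Reasoning
    F : Vec Bool (suc a) → ℤ
    F U = h (size U) (size (Vec.map not U))

module SupportedVectors where

  open import Data.Nat using (ℕ; zero; suc; _+_; _*_; _∸_; s≤s)
  open import Data.Nat.Combinatorics using (_C_; nCk+nC[k+1]≡[n+1]C[k+1])
  import Data.Nat.Properties as ℕP
  open import Data.Nat.ListAction using (sum)
  open import Data.Bool using (Bool; true; false; T)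
  open import Data.Vec using (Vec; []; _∷_; toList)
  import Data.Vec.Properties as VP
  open import Data.Vec.Relation.Binary.Pointwise.Inductive using (Pointwise; []; _∷_)
  open import Data.List as List using (List; []; _∷_; _++_; map; length; filter; applyUpTo)
  import Data.List.Properties as LP
  open import Data.List.Membership.Propositional using (_∈_)
  open import Data.List.Membership.Propositional.Properties
    using (∈-map⁺; ∈-map⁻; ∈-++⁺ˡ; ∈-++⁺ʳ; ∈-++⁻; ∈-applyUpTo⁺; ∈-applyUpTo⁻)
  open import Data.List.Relation.Unary.Any using (here; there)
  import Data.List.Relation.Unary.All as All
  open import Data.List.Relation.Unary.AllPairs using ([]; _∷_)
  open import Data.List.Relation.Unary.Unique.Propositional using (Unique)
  import Data.List.Relation.Unary.Unique.Propositional.Properties as Unique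
  open import Data.Product using (_×_; _,_)
  open import Data.Sum using (inj₁; inj₂)
  open import Data.Empty using (⊥-elim)
  open import Data.Unit using (tt)
  open import Relation.Nullary using (¬_)
  open import Relation.Nullary.Decidable using (¬?)
  open import Relation.Binary.PropositionalEquality
  open import Function using (_∘_; _⇔_; mk⇔)
  open InclusionExclusion using (size)

  -- Number of compositions of b into c positive parts (the first part is y + 1).
  -- The clause order makes  W(b+1, c+1) = W(b, c) + W(b, c+1)  hold definitionally.
  compositions : ℕ → ℕ → ℕ
  compositions b (suc c) = sum (applyUpTo (λ y → compositions (b ∸ suc y) c) b)
  compositions zero zero = 1
  compositions (suc b) zero = 0

  compositions-closed : ∀ b c → compositions (suc b) (suc c) ≡ b C c
  compositions-closed zero zero = refl
  compositions-closed zero (suc c) = refl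
  compositions-closed (suc b) zero = compositions-closed b zero
  compositions-closed (suc b) (suc c) =
    trans (cong₂ _+_ (compositions-closed b c) (compositions-closed b (suc c)))
          (nCk+nC[k+1]≡[n+1]C[k+1] b c)

  module _ {A : Set} {n : ℕ} where

    withHead : List A → (A → List (Vec A n)) → List (Vec A (suc n))
    withHead xs tails = List.concatMap (λ x → map (x ∷_) (tails x)) xs

    ∈-withHead⁺ : ∀ {xs tails x v} → x ∈ xs → v ∈ tails x → (x ∷ v) ∈ withHead xs tails
    ∈-withHead⁺ {x ∷ xs} {tails} (here refl) v∈ = ∈-++⁺ˡ (∈-map⁺ (_ ∷_) v∈)
    ∈-withHead⁺ {y ∷ xs} {tails} (there x∈) v∈ =
      ∈-++⁺ʳ (map (y ∷_) (tails y)) (∈-withHead⁺ x∈ v∈)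

    ∈-withHead⁻ : ∀ xs {tails x v} → (x ∷ v) ∈ withHead xs tails → x ∈ xs × v ∈ tails x
    ∈-withHead⁻ (y ∷ xs) {tails} x∷v∈ with ∈-++⁻ (map (y ∷_) (tails y)) x∷v∈
    ... | inj₁ x∷v∈map with ∈-map⁻ (y ∷_) x∷v∈map
    ...   | _ , v∈ , refl = here refl , v∈
    ∈-withHead⁻ (y ∷ xs) {tails} x∷v∈ | inj₂ x∷v∈rest with ∈-withHead⁻ xs x∷v∈rest
    ...   | x∈ , v∈ = there x∈ , v∈

    -- Distinct heads give disjoint blocks, so no vector is listed twice.
    withHead-unique : ∀ {xs tails} → Unique xs → (∀ x → Unique (tails x)) → Unique (withHead xs tails)
    withHead-unique {[]} [] _ = []
    withHead-unique {x ∷ xs} {tails} (x∉xs ∷ xs!) tails! =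
      Unique.++⁺ (Unique.map⁺ VP.∷-injectiveʳ (tails! x)) (withHead-unique xs! tails!) disjoint
      where
      disjoint : ∀ {w} → ¬ (w ∈ map (x ∷_) (tails x) × w ∈ withHead xs tails)
      disjoint (w∈map , w∈rest) with ∈-map⁻ (x ∷_) w∈map
      ... | _ , _ , refl with ∈-withHead⁻ xs w∈rest
      ...   | x∈xs , _ = All.lookup x∉xs x∈xs refl

    length-withHead : ∀ xs {tails} (k : ℕ) (g : A → ℕ) → (∀ x → length (tails x) ≡ k * g x) →
                      length (withHead xs tails) ≡ k * sum (map g xs)
    length-withHead [] k g hyp = sym (ℕP.*-zeroʳ k)
    length-withHead (x ∷ xs) {tails} k g hyp = begin
      length (map (x ∷_) (tails x) ++ withHead xs tails)
        ≡⟨ LP.length-++ (map (x ∷_) (tails x)) ⟩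
      length (map (x ∷_) (tails x)) + length (withHead xs tails)
        ≡⟨ cong₂ _+_ (trans (LP.length-map (x ∷_) (tails x)) (hyp x)) (length-withHead xs k g hyp) ⟩
      k * g x + k * sum (map g xs)
        ≡⟨ sym (ℕP.*-distribˡ-+ k (g x) _) ⟩
      k * sum (map g (x ∷ xs)) ∎
      where open ≡-Reasoning

  Vanishes : Bool → ℕ → Set
  Vanishes t x = ¬ T t → x ≡ 0

  Supported : ∀ {n} → Vec Bool n → Vec ℕ n → Set
  Supported = Pointwise Vanishes

  -- Number of nonzero entries (the same expression as in numPairs).
  nonzeros : List ℕ → ℕ
  nonzeros xs = length (filter (λ x → ¬? (x ℕP.≟ 0)) xs)

  vectors : ∀ {n} → Vec Bool n → ℕ → ℕ → List (Vec ℕ n)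
  vectors [] zero zero = [] ∷ []
  vectors [] zero (suc c) = []
  vectors [] (suc b) c = []
  vectors (false ∷ s) b c = map (0 ∷_) (vectors s b c)
  vectors (true ∷ s) b zero = map (0 ∷_) (vectors s b zero)
  vectors (true ∷ s) b (suc c) =
    map (0 ∷_) (vectors s b (suc c)) ++ withHead (applyUpTo suc b) (λ x → vectors s (b ∸ x) c)

  Describes : ∀ {n} → Vec Bool n → ℕ → ℕ → Vec ℕ n → Set
  Describes s b c v = Supported s v × sum (toList v) ≡ b × nonzeros (toList v) ≡ c

  ∈-vectors⁻ : ∀ {n} (s : Vec Bool n) b c {v} → v ∈ vectors s b c → Describes s b c v
  ∈-vectors⁻ [] zero zero (here refl) = [] , refl , refl
  ∈-vectors⁻ (false ∷ s) b c v∈ with ∈-map⁻ (0 ∷_) v∈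
  ... | w , w∈ , refl with ∈-vectors⁻ s b c w∈
  ...   | sup , Σw , nzw = (λ _ → refl) ∷ sup , Σw , nzw
  ∈-vectors⁻ (true ∷ s) b zero v∈ with ∈-map⁻ (0 ∷_) v∈
  ... | w , w∈ , refl with ∈-vectors⁻ s b zero w∈
  ...   | sup , Σw , nzw = (λ _ → refl) ∷ sup , Σw , nzw
  ∈-vectors⁻ (true ∷ s) b (suc c) v∈ with ∈-++⁻ (map (0 ∷_) (vectors s b (suc c))) v∈
  ∈-vectors⁻ (true ∷ s) b (suc c) v∈ | inj₁ v∈zeroHead with ∈-map⁻ (0 ∷_) v∈zeroHead
  ... | w , w∈ , refl with ∈-vectors⁻ s b (suc c) w∈
  ...   | sup , Σw , nzw = (λ _ → refl) ∷ sup , Σw , nzw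
  ∈-vectors⁻ (true ∷ s) b (suc c) {x ∷ w} v∈ | inj₂ v∈posHead
    with ∈-withHead⁻ (applyUpTo suc b) v∈posHead
  ... | x∈ , w∈ with ∈-applyUpTo⁻ suc x∈ | ∈-vectors⁻ s (b ∸ x) c w∈
  ...   | y , y<b , refl | sup , Σw , refl =
    (λ notTrue → ⊥-elim (notTrue tt)) ∷ sup , trans (cong (suc y +_) Σw) (ℕP.m+[n∸m]≡n y<b) , refl

  ∈-vectors⁺ : ∀ {n} (s : Vec Bool n) (v : Vec ℕ n) → Supported s v →
               v ∈ vectors s (sum (toList v)) (nonzeros (toList v))
  ∈-vectors⁺ [] [] [] = here refl
  ∈-vectors⁺ (false ∷ s) (x ∷ v) (x≡0 ∷ sup) with x≡0 (λ ())
  ... | refl = ∈-map⁺ (0 ∷_) (∈-vectors⁺ s v sup)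
  ∈-vectors⁺ (true ∷ s) (zero ∷ v) (_ ∷ sup) with nonzeros (toList v) | ∈-vectors⁺ s v sup
  ... | zero | v∈ = ∈-map⁺ (0 ∷_) v∈
  ... | suc c | v∈ = ∈-++⁺ˡ (∈-map⁺ (0 ∷_) v∈)
  ∈-vectors⁺ (true ∷ s) (suc y ∷ v) (_ ∷ sup) =
    ∈-++⁺ʳ (map (0 ∷_) (vectors s (suc y + Σv) (suc (nonzeros (toList v)))))
      (∈-withHead⁺ (∈-applyUpTo⁺ suc (s≤s (ℕP.m≤m+n y Σv)))
                   (subst (λ r → v ∈ vectors s r (nonzeros (toList v))) (sym (ℕP.m+n∸m≡n (suc y) Σv))
                          (∈-vectors⁺ s v sup)))
    where Σv = sum (toList v)

  vectors-unique : ∀ {n} (s : Vec Bool n) b c → Unique (vectors s b c)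
  vectors-unique [] zero zero = All.[] ∷ []
  vectors-unique [] zero (suc c) = []
  vectors-unique [] (suc b) c = []
  vectors-unique (false ∷ s) b c = Unique.map⁺ VP.∷-injectiveʳ (vectors-unique s b c)
  vectors-unique (true ∷ s) b zero = Unique.map⁺ VP.∷-injectiveʳ (vectors-unique s b zero)
  vectors-unique (true ∷ s) b (suc c) =
    Unique.++⁺ (Unique.map⁺ VP.∷-injectiveʳ (vectors-unique s b (suc c)))
               (withHead-unique positives! (λ x → vectors-unique s (b ∸ x) c))
               disjoint
    where
    positives! : Unique (applyUpTo suc b)
    positives! = Unique.applyUpTo⁺₁ suc b (λ i<j _ → ℕP.<⇒≢ i<j ∘ ℕP.suc-injective)
    disjoint : ∀ {v} → ¬ (v ∈ map (0 ∷_) (vectors s b (suc c))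
                          × v ∈ withHead (applyUpTo suc b) (λ x → vectors s (b ∸ x) c))
    disjoint (v∈zeroHead , v∈posHead) with ∈-map⁻ (0 ∷_) v∈zeroHead
    ... | _ , _ , refl with ∈-withHead⁻ (applyUpTo suc b) v∈posHead
    ...   | 0∈positives , _ with ∈-applyUpTo⁻ suc 0∈positives
    ...     | _ , _ , ()

  -- Choose which c of the #s allowed positions are nonzero, then a composition of b.
  length-vectors : ∀ {n} (s : Vec Bool n) b c → length (vectors s b c) ≡ (size s C c) * compositions b c
  length-vectors [] zero zero = refl
  length-vectors [] zero (suc c) = refl
  length-vectors [] (suc b) zero = refl
  length-vectors [] (suc b) (suc c) = refl
  length-vectors (false ∷ s) b c = trans (LP.length-map (0 ∷_) (vectors s b c)) (length-vectors s b c)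
  length-vectors (true ∷ s) b zero = trans (LP.length-map (0 ∷_) (vectors s b zero)) (length-vectors s b zero)
  length-vectors (true ∷ s) b (suc c) = begin
    length (map (0 ∷_) (vectors s b (suc c)) ++ positiveHead)
      ≡⟨ LP.length-++ (map (0 ∷_) (vectors s b (suc c))) ⟩
    length (map (0 ∷_) (vectors s b (suc c))) + length positiveHead
      ≡⟨ cong₂ _+_ (trans (LP.length-map (0 ∷_) (vectors s b (suc c))) (length-vectors s b (suc c)))
                   (length-withHead (applyUpTo suc b) (size s C c) (λ x → compositions (b ∸ x) c)
                                    (λ x → length-vectors s (b ∸ x) c)) ⟩
    (size s C suc c) * W + (size s C c) * sum (map (λ x → compositions (b ∸ x) c) (applyUpTo suc b))
      ≡⟨ cong (λ l → (size s C suc c) * W + (size s C c) * sum l)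
              (LP.map-applyUpTo suc (λ x → compositions (b ∸ x) c) b) ⟩
    (size s C suc c) * W + (size s C c) * W
      ≡⟨ sym (ℕP.*-distribʳ-+ W (size s C suc c) (size s C c)) ⟩
    (size s C suc c + size s C c) * W
      ≡⟨ cong (_* W) (trans (ℕP.+-comm (size s C suc c) (size s C c))
                            (nCk+nC[k+1]≡[n+1]C[k+1] (size s) c)) ⟩
    (suc (size s) C suc c) * W ∎
    where
    open ≡-Reasoning
    W = compositions b (suc c)
    positiveHead = withHead (applyUpTo suc b) (λ x → vectors s (b ∸ x) c)

  ∈-vectors : ∀ {n} (s : Vec Bool n) b c {v} → v ∈ vectors s b c ⇔ Describes s b c v
  ∈-vectors s b c {v} = mk⇔ (∈-vectors⁻ s b c) complete
    where
    complete : Describes s b c v → v ∈ vectors s b c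
    complete (sup , refl , refl) = ∈-vectors⁺ s v sup

module DuplicateFreeLists where

  open import Data.List using (List; length)
  open import Data.List.Membership.Propositional using (_∈_)
  open import Data.List.Relation.Unary.Unique.Propositional using (Unique)
  open import Data.List.Membership.Propositional.Properties.WithK using (unique∧set⇒bag)
  open import Data.List.Relation.Binary.BagAndSetEquality using (∼bag⇒↭)
  open import Data.List.Relation.Binary.Permutation.Propositional.Properties using (↭-length)
  open import Relation.Binary.PropositionalEquality using (_≡_)
  open import Function using (_⇔_)

  sameMembers⇒sameLength : {A : Set} {xs ys : List A} → Unique xs → Unique ys →
                           (∀ {x} → x ∈ xs ⇔ x ∈ ys) → length xs ≡ length ys
  sameMembers⇒sameLength xs! ys! same = ↭-length (∼bag⇒↭ (unique∧set⇒bag xs! ys! same))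

-- Matrices, handled through their row-by-row flattening.
module Matrices where

  open import Data.Nat using (ℕ; _*_)
  open import Data.Nat.Combinatorics using (_C_)
  open import Data.Nat.ListAction using (sum)
  open import Data.Bool using (Bool; T)
  open import Data.Vec as Vec using (Vec; []; _∷_; lookup; concat; toList)
  import Data.Vec.Properties as VP
  import Data.Vec.Relation.Binary.Pointwise.Inductive as Pointwise
  open import Data.Vec.Relation.Binary.Pointwise.Extensional using (ext; extensional⇒inductive)
  open import Data.List as List using (List; map; length)
  import Data.List.Properties as LP
  open import Data.List.Membership.Propositional using (_∈_)
  open import Data.List.Membership.Propositional.Properties using (∈-map⁺; ∈-map⁻)
  open import Data.List.Relation.Unary.Unique.Propositional using (Unique)
  import Data.List.Relation.Unary.Unique.Propositional.Properties as Unique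
  open import Data.Product using (_×_; _,_; proj₁; proj₂)
  open import Relation.Nullary using (¬_)
  open import Relation.Binary.PropositionalEquality
  open import Function using (_⇔_; mk⇔; Equivalence)
  open import Defs using (Mult; numEdges; numPairs)
  open InclusionExclusion using (size)
  open SupportedVectors

  open Equivalence using (to; from)

  concat-injective : ∀ {A : Set} {k n} (M M′ : Vec (Vec A n) k) → concat M ≡ concat M′ → M ≡ M′
  concat-injective [] [] _ = refl
  concat-injective (r ∷ M) (r′ ∷ M′) eq with VP.++-injective r r′ eq
  ... | refl , eq′ = cong (r ∷_) (concat-injective M M′ eq′)

  module _ {A : Set} (m n : ℕ) where

    unflatten : Vec A (m * n) → Vec (Vec A n) m
    unflatten v = proj₁ (Vec.group m n v)

    concat-unflatten : (v : Vec A (m * n)) → concat (unflatten v) ≡ v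
    concat-unflatten v = sym (proj₂ (Vec.group m n v))

    unflatten-concat : (M : Vec (Vec A n) m) → unflatten (concat M) ≡ M
    unflatten-concat M = concat-injective _ M (concat-unflatten (concat M))

    ∈-map-unflatten : ∀ {vs : List (Vec A (m * n))} {M} → M ∈ map unflatten vs ⇔ concat M ∈ vs
    ∈-map-unflatten {vs} {M} = mk⇔ forth back
      where
      forth : M ∈ map unflatten vs → concat M ∈ vs
      forth M∈ with ∈-map⁻ unflatten M∈
      ... | v , v∈ , refl = subst (_∈ vs) (sym (concat-unflatten v)) v∈
      back : concat M ∈ vs → M ∈ map unflatten vs
      back M∈ = subst (_∈ map unflatten vs) (unflatten-concat M) (∈-map⁺ unflatten M∈)

  entries-concat : ∀ {m n} (M : Vec (Vec ℕ n) m) → List.concat (map toList (toList M)) ≡ toList (concat M)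
  entries-concat [] = refl
  entries-concat (r ∷ M) = trans (cong (toList r List.++_) (entries-concat M)) (sym (VP.toList-++ r (concat M)))

  SupportedOn : ∀ {m n} → Vec (Vec Bool n) m → Vec (Vec ℕ n) m → Set
  SupportedOn S M = ∀ i j → ¬ T (lookup (lookup S i) j) → lookup (lookup M i) j ≡ 0

  Supported-concat : ∀ {m n} (S : Vec (Vec Bool n) m) (M : Vec (Vec ℕ n) m) →
                     Supported (concat S) (concat M) ⇔ SupportedOn S M
  Supported-concat S M = mk⇔ forth back
    where
    forth : Supported (concat S) (concat M) → SupportedOn S M
    forth sup i j = Pointwise.lookup (Pointwise.lookup (Pointwise.concat⁻ S M sup) i) j
    back : SupportedOn S M → Supported (concat S) (concat M)
    back sup = Pointwise.concat⁺ {xss = S} {yss = M}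
                 (extensional⇒inductive (ext λ i → extensional⇒inductive (ext (sup i))))

  matrices : ∀ {a} → Vec (Vec Bool a) a → ℕ → ℕ → List (Mult a)
  matrices {a} S b c = map (unflatten a a) (vectors (concat S) b c)

  ∈-matrices : ∀ {a} (S : Vec (Vec Bool a) a) b c {M} →
               M ∈ matrices S b c ⇔ (SupportedOn S M × numEdges M ≡ b × numPairs M ≡ c)
  ∈-matrices {a} S b c {M} = mk⇔ forth back
    where
    forth : M ∈ matrices S b c → SupportedOn S M × numEdges M ≡ b × numPairs M ≡ c
    forth M∈ with ∈-vectors (concat S) b c .to (∈-map-unflatten a a {vs = vectors (concat S) b c} .to M∈)
    ... | sup , edges , pairs = Supported-concat S M .to sup
                              , trans (cong sum (entries-concat M)) edges
                              , trans (cong nonzeros (entries-concat M)) pairs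
    back : SupportedOn S M × numEdges M ≡ b × numPairs M ≡ c → M ∈ matrices S b c
    back (sup , edges , pairs) =
      ∈-map-unflatten a a {vs = vectors (concat S) b c} .from (∈-vectors (concat S) b c .from
        ( Supported-concat S M .from sup
        , trans (cong sum (sym (entries-concat M))) edges
        , trans (cong nonzeros (sym (entries-concat M))) pairs))

  matrices-unique : ∀ {a} (S : Vec (Vec Bool a) a) b c → Unique (matrices S b c)
  matrices-unique {a} S b c = Unique.map⁺ unflatten-injective (vectors-unique (concat S) b c)
    where
    unflatten-injective : ∀ {v w} → unflatten a a v ≡ unflatten a a w → v ≡ w
    unflatten-injective {v} {w} eq =
      trans (sym (concat-unflatten a a v)) (trans (cong concat eq) (concat-unflatten a a w))

  length-matrices : ∀ {a} (S : Vec (Vec Bool a) a) b c →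
                    length (matrices S b c) ≡ (size (concat S) C c) * compositions b c
  length-matrices {a} S b c =
    trans (LP.length-map (unflatten a a) (vectors (concat S) b c)) (length-vectors (concat S) b c)

module Shapes where

  open import Data.Nat using (zero; suc; _+_; _≤_; _<_; _<ᵇ_)
  open import Data.Nat.Combinatorics using (_C_; nC1≡n; nCk+nC[k+1]≡[n+1]C[k+1])
  import Data.Nat.Properties as ℕP
  open import Data.Bool using (Bool; true; false; _∧_; not; T)
  open import Data.Bool.Properties using (T-∧; T-not-≡)
  open import Data.Fin using (Fin; zero; suc; toℕ)
  open import Data.Vec as Vec using (Vec; []; _∷_; lookup; concat; _++_)
  import Data.Vec.Properties as VP
  open import Data.Product using (_×_; _,_; proj₁; proj₂)
  open import Data.Empty using (⊥-elim)
  open import Relation.Nullary using (yes; no)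
  open import Relation.Binary.PropositionalEquality
  open import Function using (_⇔_; mk⇔; Equivalence)
  open import Defs using (Mult; entry)
  open InclusionExclusion using (size)
  open Matrices using (SupportedOn)

  open Equivalence using (to; from)

  shape : ∀ {a} → Vec Bool a → Vec (Vec Bool a) a
  shape [] = []
  shape (u ∷ U) = (false ∷ Vec.map (λ v → not u ∧ not v) U) ∷ Vec.map (false ∷_) (shape U)

  shape-lookup : ∀ {a} (U : Vec Bool a) i j →
    lookup (lookup (shape U) i) j ≡ (toℕ i <ᵇ toℕ j) ∧ (not (lookup U i) ∧ not (lookup U j))
  shape-lookup (u ∷ U) zero zero = refl
  shape-lookup (u ∷ U) zero (suc j) = VP.lookup-map j (λ v → not u ∧ not v) U
  shape-lookup (u ∷ U) (suc i) zero = cong (λ r → lookup r zero) (VP.lookup-map i (false ∷_) (shape U))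
  shape-lookup (u ∷ U) (suc i) (suc j) =
    trans (cong (λ r → lookup r (suc j)) (VP.lookup-map i (false ∷_) (shape U))) (shape-lookup U i j)

  T-shape : ∀ {a} (U : Vec Bool a) i j →
    T (lookup (lookup (shape U) i) j) ⇔ (toℕ i < toℕ j × lookup U i ≡ false × lookup U j ≡ false)
  T-shape U i j = mk⇔ forth back
    where
    forth : T (lookup (lookup (shape U) i) j) → toℕ i < toℕ j × lookup U i ≡ false × lookup U j ≡ false
    forth t with T-∧ .to (subst T (shape-lookup U i j) t)
    ... | i<j , outside with T-∧ .to outside
    ...   | i∉U , j∉U = ℕP.<ᵇ⇒< (toℕ i) (toℕ j) i<j , T-not-≡ .to i∉U , T-not-≡ .to j∉U
    back : toℕ i < toℕ j × lookup U i ≡ false × lookup U j ≡ false → T (lookup (lookup (shape U) i) j)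
    back (i<j , i∉U , j∉U) = subst T (sym (shape-lookup U i j))
      (T-∧ .from (ℕP.<⇒<ᵇ i<j , T-∧ .from (T-not-≡ .from i∉U , T-not-≡ .from j∉U)))

  size-++ : ∀ {m n} (r : Vec Bool m) (s : Vec Bool n) → size (r ++ s) ≡ size r + size s
  size-++ [] s = refl
  size-++ (true ∷ r) s = cong suc (size-++ r s)
  size-++ (false ∷ r) s = size-++ r s
  size-falses : ∀ {n} (U : Vec Bool n) → size (Vec.map (λ _ → false) U) ≡ 0
  size-falses [] = refl
  size-falses (u ∷ U) = size-falses U

  size-shiftRows : ∀ {m n} (S : Vec (Vec Bool n) m) → size (concat (Vec.map (false ∷_) S)) ≡ size (concat S)
  size-shiftRows [] = refl
  size-shiftRows (r ∷ S) =
    trans (size-++ r _) (trans (cong (size r +_) (size-shiftRows S)) (sym (size-++ r (concat S))))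

  size-shape : ∀ {a} (U : Vec Bool a) → size (concat (shape U)) ≡ size (Vec.map not U) C 2
  size-shape [] = refl
  size-shape (true ∷ U) =
    trans (size-++ (Vec.map (λ _ → false) U) _)
          (trans (cong₂ _+_ (size-falses U) (size-shiftRows (shape U))) (size-shape U))
  size-shape (false ∷ U) =
    trans (size-++ (Vec.map not U) _)
          (trans (cong₂ _+_ (sym (nC1≡n n)) (trans (size-shiftRows (shape U)) (size-shape U)))
                 (nCk+nC[k+1]≡[n+1]C[k+1] n 1))
    where n = size (Vec.map not U)

  UpperTriangular : ∀ {a} → Mult a → Set
  UpperTriangular {a} M = ∀ (i j : Fin a) → toℕ j ≤ toℕ i → entry M i j ≡ 0

  Isolated : ∀ {a} → Mult a → Fin a → Set
  Isolated M i = ∀ j → entry M i j ≡ 0 × entry M j i ≡ 0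

  shape-support : ∀ {a} (U : Vec Bool a) (M : Mult a) →
    SupportedOn (shape U) M ⇔ (UpperTriangular M × (∀ i → lookup U i ≡ true → Isolated M i))
  shape-support U M = mk⇔ forth back
    where
    forth : SupportedOn (shape U) M → UpperTriangular M × (∀ i → lookup U i ≡ true → Isolated M i)
    forth sup = upper , isolated
      where
      upper : UpperTriangular M
      upper i j j≤i = sup i j (λ t → ℕP.<⇒≱ (proj₁ (T-shape U i j .to t)) j≤i)
      isolated : ∀ i → lookup U i ≡ true → Isolated M i
      isolated i i∈U j =
          sup i j (λ t → true≢false (trans (sym i∈U) (proj₁ (proj₂ (T-shape U i j .to t)))))
        , sup j i (λ t → true≢false (trans (sym i∈U) (proj₂ (proj₂ (T-shape U j i .to t)))))
        where
        true≢false : true ≢ false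
        true≢false ()
    back : UpperTriangular M × (∀ i → lookup U i ≡ true → Isolated M i) → SupportedOn (shape U) M
    back (upper , isolated) i j notAllowed with toℕ i ℕP.<? toℕ j | lookup U i in i∈? | lookup U j in j∈?
    ... | no i≮j | _ | _ = upper i j (ℕP.≮⇒≥ i≮j)
    ... | yes _ | true | _ = proj₁ (isolated i i∈? j)
    ... | yes _ | false | true = proj₂ (isolated j j∈? i)
    ... | yes i<j | false | false = ⊥-elim (notAllowed (T-shape U i j .from (i<j , i∈? , j∈?)))

module WebWorlds where

  open import Data.Nat as ℕ using (ℕ; suc; _∸_)
  open import Data.Nat.Combinatorics using (_C_)
  import Data.Nat.Properties as ℕP
  open import Data.Bool using (Bool; true; false; not; T)
  open import Data.Bool.Properties using (T?)
  open import Data.Empty using (⊥-elim)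
  open import Data.Fin using (Fin)
  open import Data.Fin.Properties using (any?)
  open import Data.Vec as Vec using (Vec; lookup)
  import Data.Vec.Properties as VP
  open import Data.Integer using (ℤ; +_; -1ℤ; _*_; _^_)
  import Data.Integer.Properties as ℤP
  open import Data.Integer.Tactic.RingSolver using (solve-∀)
  open import Data.List using (List; length; filterᵇ; upTo)
  open import Data.List.Membership.Propositional using (_∈_)
  open import Data.List.Membership.Propositional.Properties using (∈-filter⁺; ∈-filter⁻)
  open import Data.List.Relation.Unary.Unique.Propositional using (Unique)
  import Data.List.Relation.Unary.Unique.Propositional.Properties as Unique
  open import Data.Product using (∃; _×_; _,_; proj₁; proj₂)
  open import Data.Sum using (_⊎_; inj₁; inj₂)
  open import Relation.Nullary using (¬_)
  open import Relation.Nullary.Decidable using (¬?; _⊎-dec_; isYes; toWitness; fromWitness; decidable-stable)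
  open import Relation.Binary.PropositionalEquality
  open import Function using (_∘_; _⇔_; mk⇔; Equivalence)
  open import Defs using (Mult; entry; numEdges; numPairs; IsWW; altSum)
  open ListSums
  open InclusionExclusion
  open SubsetsBySize
  open SupportedVectors using (compositions)
  open Matrices
  open Shapes
  open DuplicateFreeLists

  open Equivalence using (to; from)

  Incident : ∀ {a} → Mult a → Fin a → Set
  Incident M i = ∃ λ j → (entry M i j ≢ 0) ⊎ (entry M j i ≢ 0)

  covered : ∀ {a} → Mult a → Fin a → Bool
  covered M i = isYes (any? (λ j → ¬? (entry M i j ℕP.≟ 0) ⊎-dec ¬? (entry M j i ℕP.≟ 0)))

  T-covered : ∀ {a} (M : Mult a) i → T (covered M i) ⇔ Incident M i
  T-covered M i = mk⇔ toWitness fromWitness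

  ¬covered : ∀ {a} (M : Mult a) i → (¬ T (covered M i)) ⇔ Isolated M i
  ¬covered M i = mk⇔ forth back
    where
    forth : ¬ T (covered M i) → Isolated M i
    forth notCovered j =
        decidable-stable (entry M i j ℕP.≟ 0) (λ ne → notCovered (T-covered M i .from (j , inj₁ ne)))
      , decidable-stable (entry M j i ℕP.≟ 0) (λ ne → notCovered (T-covered M i .from (j , inj₂ ne)))
    back : Isolated M i → ¬ T (covered M i)
    back isolated c with T-covered M i .to c
    ... | j , inj₁ ne = ne (proj₁ (isolated j))
    ... | j , inj₂ ne = ne (proj₂ (isolated j))

  -- The empty set of pegs; shape (∅ a) is the strictly upper-triangular mask.
  ∅ : ∀ a → Vec Bool a
  ∅ a = Vec.replicate a false

  candidates : ∀ a → ℕ → ℕ → List (Mult a)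
  candidates a b c = matrices (shape (∅ a)) b c

  -- The isolation part of shape-support is vacuous for U = ∅.
  ∈-candidates : ∀ a b c {M} →
    M ∈ candidates a b c ⇔ (UpperTriangular M × numEdges M ≡ b × numPairs M ≡ c)
  ∈-candidates a b c {M} = mk⇔ forth back
    where
    noPeg : ∀ i → lookup (∅ a) i ≢ true
    noPeg i i∈ with trans (sym (VP.lookup-replicate i false)) i∈
    ... | ()
    forth : M ∈ candidates a b c → UpperTriangular M × numEdges M ≡ b × numPairs M ≡ c
    forth M∈ with ∈-matrices (shape (∅ a)) b c .to M∈
    ... | sup , edges , pairs = proj₁ (shape-support (∅ a) M .to sup) , edges , pairs
    back : UpperTriangular M × numEdges M ≡ b × numPairs M ≡ c → M ∈ candidates a b c
    back (upper , edges , pairs) =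
      ∈-matrices (shape (∅ a)) b c .from
        (shape-support (∅ a) M .from (upper , λ i i∈ → ⊥-elim (noPeg i i∈)) , edges , pairs)

  webWorlds : ∀ a → ℕ → ℕ → List (Mult a)
  webWorlds a b c = filterᵇ (every ∘ covered) (candidates a b c)

  ∈-webWorlds : ∀ a b c {M} → M ∈ webWorlds a b c ⇔ IsWW a b c M
  ∈-webWorlds a b c {M} = mk⇔ forth back
    where
    forth : M ∈ webWorlds a b c → IsWW a b c M
    forth M∈ with ∈-filter⁻ (T? ∘ every ∘ covered) M∈
    ... | M∈cands , allCovered with ∈-candidates a b c .to M∈cands
    ...   | upper , edges , pairs =
      upper , (λ i → T-covered M i .to (T-every (covered M) .to allCovered i)) , edges , pairs
    back : IsWW a b c M → M ∈ webWorlds a b c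
    back (upper , incident , edges , pairs) =
      ∈-filter⁺ (T? ∘ every ∘ covered) (∈-candidates a b c .from (upper , edges , pairs))
                (T-every (covered M) .from (λ i → T-covered M i .from (incident i)))

  webWorlds-unique : ∀ a b c → Unique (webWorlds a b c)
  webWorlds-unique a b c = Unique.filter⁺ (T? ∘ every ∘ covered) (matrices-unique (shape (∅ a)) b c)

  count-isolated : ∀ a b c (U : Vec Bool a) →
    length (filterᵇ (noneIn U ∘ covered) (candidates a b c))
      ≡ ((size (Vec.map not U) C 2) C c) ℕ.* compositions b c
  count-isolated a b c U =
    trans (sameMembers⇒sameLength
             (Unique.filter⁺ (T? ∘ noneIn U ∘ covered) (matrices-unique (shape (∅ a)) b c))
             (matrices-unique (shape U) b c) (mk⇔ forth back))
    (trans (length-matrices (shape U) b c) (cong (λ n → (n C c) ℕ.* compositions b c) (size-shape U)))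
    where
    forth : ∀ {M} → M ∈ filterᵇ (noneIn U ∘ covered) (candidates a b c) → M ∈ matrices (shape U) b c
    forth {M} M∈ with ∈-filter⁻ (T? ∘ noneIn U ∘ covered) M∈
    ... | M∈cands , avoidsU with ∈-candidates a b c .to M∈cands
    ...   | upper , edges , pairs =
      ∈-matrices (shape U) b c .from
        (shape-support U M .from
           (upper , λ i i∈U → ¬covered M i .to (T-noneIn U (covered M) .to avoidsU i i∈U))
        , edges , pairs)
    back : ∀ {M} → M ∈ matrices (shape U) b c → M ∈ filterᵇ (noneIn U ∘ covered) (candidates a b c)
    back {M} M∈ with ∈-matrices (shape U) b c .to M∈
    ... | sup , edges , pairs with shape-support U M .to sup
    ...   | upper , isolated =
      ∈-filter⁺ (T? ∘ noneIn U ∘ covered) (∈-candidates a b c .from (upper , edges , pairs))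
                (T-noneIn U (covered M) .from (λ i i∈U → ¬covered M i .from (isolated i i∈U)))

  altSum-binomialSum : ∀ a c → altSum a c ≡ binomialSum a (λ t f → -1ℤ ^ t * + ((f C 2) C c))
  altSum-binomialSum a c =
    ∑-cong (upTo (suc a)) (λ k → reorder (+ (a C k)) (+ ((k C 2) C c)) (-1ℤ ^ (a ∸ k)))
    where
    reorder : ∀ x y z → x * y * z ≡ x * (z * y)
    reorder = solve-∀

  -- Inclusion–exclusion over the set U of pegs forced to be isolated, then grouping by |U|.
  webWorlds-count : ∀ a b c → + length (webWorlds a b c) ≡ + compositions b c * altSum a c
  webWorlds-count a b c = begin
    + length (filterᵇ (every ∘ covered) (candidates a b c))
      ≡⟨ inclusion-exclusion covered (candidates a b c) ⟩
    ∑ (subsets a) (λ U → -1ℤ ^ size U * + length (filterᵇ (noneIn U ∘ covered) (candidates a b c)))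
      ≡⟨ ∑-cong (subsets a) isolatedTerm ⟩
    ∑ (subsets a) (λ U → + W * h (size U) (size (Vec.map not U)))
      ≡⟨ ∑-scale (subsets a) (+ W) (λ U → h (size U) (size (Vec.map not U))) ⟩
    + W * ∑ (subsets a) (λ U → h (size U) (size (Vec.map not U)))
      ≡⟨ cong (+ W *_) (subsets-by-size a h) ⟩
    + W * binomialSum a h
      ≡⟨ cong (+ W *_) (sym (altSum-binomialSum a c)) ⟩
    + W * altSum a c ∎
    where
    open ≡-Reasoning
    W = compositions b c
    h : ℕ → ℕ → ℤ
    h t f = -1ℤ ^ t * + ((f C 2) C c)
    isolatedTerm : ∀ U → -1ℤ ^ size U * + length (filterᵇ (noneIn U ∘ covered) (candidates a b c))
                         ≡ + W * h (size U) (size (Vec.map not U))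
    isolatedTerm U = begin
      -1ℤ ^ size U * + length (filterᵇ (noneIn U ∘ covered) (candidates a b c))
        ≡⟨ cong (λ n → -1ℤ ^ size U * + n) (count-isolated a b c U) ⟩
      -1ℤ ^ size U * + (N ℕ.* W)
        ≡⟨ cong (-1ℤ ^ size U *_) (ℤP.pos-* N W) ⟩
      -1ℤ ^ size U * (+ N * + W)
        ≡⟨ reorder (-1ℤ ^ size U) (+ N) (+ W) ⟩
      + W * h (size U) (size (Vec.map not U)) ∎
      where
      N = (size (Vec.map not U) C 2) C c
      reorder : ∀ s x w → s * (x * w) ≡ w * (s * x)
      reorder = solve-∀

-- The theorem: webWorlds lists the web worlds without repetition, and W(b, c) = C(b − 1, c − 1)
-- for b, c ≥ 1.
open import Defs
open import Data.Nat using (ℕ; _≤_; _∸_; suc; s≤s)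
open import Data.Nat.Combinatorics using (_C_)
open import Data.Integer using (+_; _*_)
open import Data.Product using (∃; _×_; _,_)
open import Data.List using (length)
open import Relation.Binary.PropositionalEquality using (_≡_; refl; trans; cong)
open SupportedVectors using (compositions-closed)
open WebWorlds

corollary4p5 : (a b c : ℕ) → 1 ≤ a → 1 ≤ b → 1 ≤ c →
    ∃ λ (n : ℕ) → HasCount (IsWW a b c) n × (+ n ≡ (+ ((b ∸ 1) C (c ∸ 1))) * altSum a c)
corollary4p5 a (suc b) (suc c) _ (s≤s _) (s≤s _) =
  length worlds ,
  (worlds , webWorlds-unique a (suc b) (suc c) , (λ M → ∈-webWorlds a (suc b) (suc c)) , refl) ,
  trans (webWorlds-count a (suc b) (suc c)) (cong (λ n → + n * altSum a (suc c)) (compositions-closed b c))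
  where worlds = webWorlds a (suc b) (suc c)
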